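{- For every integer $n\ge 2$, exactly half of the subsets $S\subseteq[n]$ satisfy $\beta^{\pm}_n(S)\equiv 1\bmod 4$, and the other half satisfy $\beta^{\pm}_n(S)\equiv 3\bmod 4$.
   Context: A signed permutation of size $n$ is a word $\pi=\pi_1\cdots\pi_n$ with each $\pi_i\in\{\pm1,\dots,\pm n\}$ such that $|\pi_1|\cdots|\pi_n|$ is a permutation of $[n]$. Setting $\pi_0=0$, the descent set of $\pi$ is $\{i\in[n]:\pi_{i-1}>\pi_i\}$. For $S\subseteq[n]$, $\beta^\pm_n(S)$ is the number of signed permutations of size $n$ with descent set $S$. -}

module Defs where

open import Data.Bool using (Bool; true; false)
open import Data.Nat using (ℕ; zero; suc)
open import Data.Integer using (ℤ; +_; -_; ∣_∣; _<_; 0ℤ)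
import Data.Integer.Properties as ℤP
open import Data.List using (List; []; _∷_; map; concatMap; length; filter; upTo)
open import Data.Vec using (Vec; []; _∷_; toList)
open import Data.Fin.Subset using (Subset)
open import Data.List.Relation.Unary.Unique.Propositional using (Unique)
import Data.List.Relation.Unary.Unique.DecPropositional as UD
open import Relation.Nullary.Decidable using (⌊_⌋)
open import Relation.Binary.PropositionalEquality using (_≡_)
open import Relation.Unary using (Decidable)

words : {A : Set} → (n : ℕ) → List A → List (Vec A n)
words zero    as = [] ∷ []
words (suc n) as = concatMap (λ a → map (a ∷_) (words n as)) as

letters : ℕ → List ℤ
letters n = concatMap (λ k → (+ suc k) ∷ (- (+ suc k)) ∷ []) (upTo n)

-- A word over {±1,…,±n} of length n is a signed permutation iff
-- |π₁|⋯|πₙ| is a permutation of [n]; given the alphabet, this holds iff the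
-- absolute values are pairwise distinct.
IsSignedPerm : {n : ℕ} → Vec ℤ n → Set
IsSignedPerm π = Unique (map ∣_∣ (toList π))

isSignedPerm? : {n : ℕ} → Decidable (IsSignedPerm {n})
isSignedPerm? π = UD.unique? Data.Nat._≟_ (map ∣_∣ (toList π))
  where import Data.Nat

-- Descent set of π (with π₀ = 0), as a subset of [n]:
-- position i (0-based, Fin n) represents the element i+1 of [n], and it is
-- in the descent set iff π_{i} > π_{i+1} (1-based indices, π₀ = 0).
desAux : {n : ℕ} → ℤ → Vec ℤ n → Subset n
desAux prev []      = []
desAux prev (x ∷ π) = ⌊ x ℤP.<? prev ⌋ ∷ desAux x π

Des : {n : ℕ} → Vec ℤ n → Subset n
Des π = desAux 0ℤ π

signedPerms : (n : ℕ) → List (Vec ℤ n)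
signedPerms n = filter isSignedPerm? (words n (letters n))

β± : (n : ℕ) → Subset n → ℕ
β± n S = length (filter (λ π → Data.Vec.Properties.≡-dec Data.Bool._≟_ (Des π) S) (signedPerms n))
  where import Data.Vec.Properties
        import Data.Bool

allSubsets : (n : ℕ) → List (Subset n)
allSubsets n = words n (true ∷ false ∷ [])

-- If the prefix ends in the letter p and
-- m₁ < m₂ are the two smallest unused values, then modulo 4 the number of ways to complete
-- it with a prescribed descent word depends only on the position of p among −m₂ < −m₁ < m₁ < m₂:
-- choosing ±m₁ or ±m₂ next leads again to such a position, while a letter ±x with x > m₂
-- lies above or below all four, and its completions then cancel modulo 4.  So β±ₙ(S) mod 4
-- is read off the final state of a four-state automaton run along S, and it is always 1 or 3.
-- The transitions of the automaton are permutations, so its states are equidistributed over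
-- the subsets S, and each of the two residues occurs for exactly half of them.

module Submission where

open import Defs
open import Data.Nat using (ℕ; _≤_; _^_; _∸_; _%_; _≟_)
open import Data.List using (length; filter)
open import Data.Product using (_×_)
open import Relation.Binary.PropositionalEquality using (_≡_)

open import Algebra using (CommutativeMonoid)
import Algebra.Properties.CommutativeSemigroup as CommutativeSemigroupProperties
open import Data.Bool using (Bool; true; false; not; _∧_; if_then_else_)
import Data.Bool as Bool
open import Data.Bool.Properties using (∧-assoc; ∧-zeroʳ; ∧-identityʳ; ∧-commutativeMonoid)
open import Data.Integer using (ℤ; +_; -_; -[1+_]; ∣_∣; 0ℤ; +<+; -<-)
open import Data.Integer.Properties using (_<?_; <-asym)
open import Data.List using (List; []; _∷_; _++_; map; concatMap; upTo; filterᵇ)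
open import Data.Bool.ListAction using (all)
open import Data.List.Properties using (map-++; map-∘; map-cong; filter-all; length-upTo)
open import Data.List.Membership.Propositional using (_∈_)
open import Data.List.Relation.Unary.All as All using (All; []; _∷_)
open import Data.List.Relation.Unary.Any using (here; there)
open import Data.List.Relation.Unary.AllPairs as AllPairs using (AllPairs; []; _∷_)
import Data.List.Relation.Unary.AllPairs.Properties as AllPairsₚ
open import Data.List.Relation.Unary.Unique.Propositional using (Unique)
open import Data.List.Relation.Unary.Unique.DecPropositional _≟_ using (unique?)
open import Data.Nat using (suc; zero; _+_; _*_; _<_; NonZero; s≤s)
open import Data.Nat.DivMod using (%-distribˡ-+)
open import Data.Nat.ListAction using (sum)
open import Data.Nat.ListAction.Properties using (sum-++)
open import Data.Nat.Properties using (+-identityʳ; +-comm; +-commutativeSemigroup; <⇒≢; <-trans; suc-injective; *-comm)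
open import Data.Nat.Solver using (module +-*-Solver)
open import Data.Product using (_,_; proj₁; proj₂)
open import Data.Unit using (tt)
open import Data.Vec using (Vec; []; _∷_; toList)
open import Data.Fin.Subset using (Subset)
open import Data.Vec.Properties using (≡-dec)
open import Function using (_∘_; id)
open import Relation.Binary.PropositionalEquality
  using (refl; sym; trans; cong; cong₂; _≢_; _≗_; ≢-sym; module ≡-Reasoning)
open import Relation.Nullary using (Dec; does; yes; no; ¬_; ¬?)
open import Relation.Nullary.Decidable using (⌊_⌋; T?; isYes≗does; dec-true; dec-false)
open import Relation.Unary using (Decidable)

private
  variable
    A B : Set

  module ∧ = CommutativeSemigroupProperties (CommutativeMonoid.commutativeSemigroup ∧-commutativeMonoid)
  module + = CommutativeSemigroupProperties +-commutativeSemigroup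

infix 4 _≈_mod_
record _≈_mod_ (a b m : ℕ) .{{_ : NonZero m}} : Set where
  constructor mod-≡
  field %-≡ : a % m ≡ b % m
open _≈_mod_

module _ {m : ℕ} .{{_ : NonZero m}} where

  mod-refl : ∀ {a} → a ≈ a mod m
  mod-refl = mod-≡ refl

  mod-trans : ∀ {a b c} → a ≈ b mod m → b ≈ c mod m → a ≈ c mod m
  mod-trans (mod-≡ p) (mod-≡ q) = mod-≡ (trans p q)

  ≡⇒mod : ∀ {a b} → a ≡ b → a ≈ b mod m
  ≡⇒mod refl = mod-refl

  +-mod-cong : ∀ {a a′ b b′} → a ≈ a′ mod m → b ≈ b′ mod m → a + b ≈ a′ + b′ mod m
  +-mod-cong {a} {a′} {b} {b′} (mod-≡ p) (mod-≡ q) = mod-≡ (begin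
    (a + b) % m            ≡⟨ %-distribˡ-+ a b m ⟩
    (a % m + b % m) % m    ≡⟨ cong₂ (λ u v → (u + v) % m) p q ⟩
    (a′ % m + b′ % m) % m  ≡⟨ %-distribˡ-+ a′ b′ m ⟨
    (a′ + b′) % m          ∎)
    where open ≡-Reasoning

  if-mod-cong : ∀ c {a b} → a ≈ b mod m → (if c then a else 0) ≈ (if c then b else 0) mod m
  if-mod-cong true  a≈b = a≈b
  if-mod-cong false _   = mod-refl

  if-mod-zero : ∀ c {a} → a ≈ 0 mod m → (if c then a else 0) ≈ 0 mod m
  if-mod-zero true  a≈0 = a≈0
  if-mod-zero false _   = mod-refl

  sum-mod-zero : ∀ (f : A → ℕ) xs → (∀ {x} → x ∈ xs → f x ≈ 0 mod m) → sum (map f xs) ≈ 0 mod m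
  sum-mod-zero f []       _   = mod-refl
  sum-mod-zero f (x ∷ xs) f≈0 = +-mod-cong (f≈0 (here refl)) (sum-mod-zero f xs (f≈0 ∘ there))

sum-map-++ : ∀ (f : A → ℕ) xs ys → sum (map f (xs ++ ys)) ≡ sum (map f xs) + sum (map f ys)
sum-map-++ f xs ys = trans (cong sum (map-++ f xs ys)) (sum-++ (map f xs) (map f ys))

sum-map-concatMap : ∀ (f : B → ℕ) (g : A → List B) xs →
  sum (map f (concatMap g xs)) ≡ sum (map (λ x → sum (map f (g x))) xs)
sum-map-concatMap f g []       = refl
sum-map-concatMap f g (x ∷ xs) =
  trans (sum-map-++ f (g x) (concatMap g xs)) (cong (_+_ (sum (map f (g x)))) (sum-map-concatMap f g xs))

sum-map-∘ : ∀ (f : B → ℕ) (g : A → B) xs → sum (map (f ∘ g) xs) ≡ sum (map f (map g xs))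
sum-map-∘ f g xs = cong sum (map-∘ xs)

sum-map-cong : ∀ {f g : A → ℕ} → f ≗ g → ∀ xs → sum (map f xs) ≡ sum (map g xs)
sum-map-cong f≗g xs = cong sum (map-cong f≗g xs)

sum-map-if : ∀ c (f : A → ℕ) xs → sum (map (λ x → if c then f x else 0) xs) ≡ (if c then sum (map f xs) else 0)
sum-map-if true  f xs       = refl
sum-map-if false f []       = refl
sum-map-if false f (x ∷ xs) = sum-map-if false f xs

sum-map-filter : ∀ {P : A → Set} (P? : Decidable P) (f : A → ℕ) xs →
  sum (map f (filter P? xs)) ≡ sum (map (λ x → if does (P? x) then f x else 0) xs)
sum-map-filter P? f []       = refl
sum-map-filter P? f (x ∷ xs) with does (P? x)
... | true  = cong (_+_ (f x)) (sum-map-filter P? f xs)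
... | false = sum-map-filter P? f xs

length-filter-as-sum : ∀ {P : A → Set} (P? : Decidable P) xs →
  length (filter P? xs) ≡ sum (map (λ x → if does (P? x) then 1 else 0) xs)
length-filter-as-sum P? []       = refl
length-filter-as-sum P? (x ∷ xs) with does (P? x)
... | true  = cong suc (length-filter-as-sum P? xs)
... | false = length-filter-as-sum P? xs

if-∧ : ∀ a b (x : ℕ) → (if a ∧ b then x else 0) ≡ (if a then (if b then x else 0) else 0)
if-∧ true  b x = refl
if-∧ false b x = refl

isYes-true : ∀ {P : Set} (P? : Dec P) → P → ⌊ P? ⌋ ≡ true
isYes-true P? p = trans (isYes≗does P?) (dec-true P? p)

isYes-false : ∀ {P : Set} (P? : Dec P) → ¬ P → ⌊ P? ⌋ ≡ false
isYes-false P? ¬p = trans (isYes≗does P?) (dec-false P? ¬p)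

does-≟-comm : ∀ x y → does (x ≟ y) ≡ does (y ≟ x)
does-≟-comm x y with x ≟ y
... | yes refl = refl
... | no x≢y   = trans (dec-false (x ≟ y) x≢y) (sym (dec-false (y ≟ x) (≢-sym x≢y)))

filterᵇ-∷ : ∀ (p : A → Bool) x xs → filterᵇ p (x ∷ xs) ≡ (if p x then x ∷ filterᵇ p xs else filterᵇ p xs)
filterᵇ-∷ p x xs with p x
... | true  = refl
... | false = refl

filterᵇ-∧ : ∀ (p q : A → Bool) xs → filterᵇ (λ x → p x ∧ q x) xs ≡ filterᵇ p (filterᵇ q xs)
filterᵇ-∧ p q []       = refl
filterᵇ-∧ p q (x ∷ xs)
  rewrite filterᵇ-∷ (λ x → p x ∧ q x) x xs | filterᵇ-∷ q x xs
  with q x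
... | false rewrite ∧-zeroʳ (p x) = filterᵇ-∧ p q xs
... | true rewrite ∧-identityʳ (p x) | filterᵇ-∷ p x (filterᵇ q xs) with p x
...   | true  = cong (x ∷_) (filterᵇ-∧ p q xs)
...   | false = filterᵇ-∧ p q xs

infixl 6 _∖_
_∖_ : List ℕ → ℕ → List ℕ
xs ∖ x = filterᵇ (λ k → not (does (k ≟ x))) xs

∖-∷-self : ∀ x xs → (x ∷ xs) ∖ x ≡ xs ∖ x
∖-∷-self x xs rewrite filterᵇ-∷ (λ k → not (does (k ≟ x))) x xs | dec-true (x ≟ x) refl = refl

∖-∷-≢ : ∀ {x y} xs → y ≢ x → (y ∷ xs) ∖ x ≡ y ∷ xs ∖ x
∖-∷-≢ {x} {y} xs y≢x rewrite filterᵇ-∷ (λ k → not (does (k ≟ x))) y xs | dec-false (y ≟ x) y≢x = refl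

∖-∉ : ∀ {x xs} → All (_≢ x) xs → xs ∖ x ≡ xs
∖-∉ []              = refl
∖-∉ (y≢x ∷ xs≢x) = trans (∖-∷-≢ _ y≢x) (cong (_ ∷_) (∖-∉ xs≢x))

length-∖ : ∀ {x xs} → Unique xs → x ∈ xs → suc (length (xs ∖ x)) ≡ length xs
length-∖ {x} (x≢xs ∷ _) (here refl) =
  cong (suc ∘ length) (trans (∖-∷-self x _) (∖-∉ (All.map ≢-sym x≢xs)))
length-∖ (y≢xs ∷ xs!) (there x∈xs) =
  trans (cong (suc ∘ length) (∖-∷-≢ _ (All.lookup y≢xs x∈xs))) (cong suc (length-∖ xs! x∈xs))

fresh : ℕ → List ℕ → Bool
fresh x = all (λ y → not (does (x ≟ y)))

freshWord : List ℕ → List ℕ → Bool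
freshWord used []       = true
freshWord used (z ∷ zs) = fresh z used ∧ freshWord (z ∷ used) zs

all-fresh-∷ : ∀ z used zs →
  all (λ y → fresh y (z ∷ used)) zs ≡ does (All.all? (λ y → ¬? (z ≟ y)) zs) ∧ all (λ y → fresh y used) zs
all-fresh-∷ z used []       = refl
all-fresh-∷ z used (y ∷ ys) = begin
  (not (does (y ≟ z)) ∧ f) ∧ all (λ y → fresh y (z ∷ used)) ys
    ≡⟨ cong₂ (λ b t → (not b ∧ f) ∧ t) (does-≟-comm y z) (all-fresh-∷ z used ys) ⟩
  (d ∧ f) ∧ (v ∧ fs)  ≡⟨ ∧.interchange d f v fs ⟩
  (d ∧ v) ∧ (f ∧ fs)  ∎
  where
  open ≡-Reasoning
  d = not (does (z ≟ y))
  f = fresh y used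
  v = does (All.all? (λ y → ¬? (z ≟ y)) ys)
  fs = all (λ y → fresh y used) ys

freshWord-unique : ∀ used zs → freshWord used zs ≡ all (λ z → fresh z used) zs ∧ does (unique? zs)
freshWord-unique used []       = refl
freshWord-unique used (z ∷ zs) = begin
  a ∧ freshWord (z ∷ used) zs                   ≡⟨ cong (a ∧_) (freshWord-unique (z ∷ used) zs) ⟩
  a ∧ (all (λ y → fresh y (z ∷ used)) zs ∧ u)   ≡⟨ cong (λ t → a ∧ (t ∧ u)) (all-fresh-∷ z used zs) ⟩
  a ∧ ((v ∧ f) ∧ u)                             ≡⟨ cong (a ∧_) (∧.xy∙z≈y∙xz v f u) ⟩
  a ∧ (f ∧ (v ∧ u))                             ≡⟨ ∧-assoc a f (v ∧ u) ⟨
  (a ∧ f) ∧ (v ∧ u)                             ∎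
  where
  open ≡-Reasoning
  a = fresh z used
  f = all (λ y → fresh y used) zs
  v = does (All.all? (λ y → ¬? (z ≟ y)) zs)
  u = does (unique? zs)

all-fresh-[] : ∀ zs → all (λ z → fresh z []) zs ≡ true
all-fresh-[] []       = refl
all-fresh-[] (z ∷ zs) = all-fresh-[] zs

isSignedPerm-freshWord : ∀ {k} (π : Vec ℤ k) → does (isSignedPerm? π) ≡ freshWord [] (map ∣_∣ (toList π))
isSignedPerm-freshWord π =
  sym (trans (freshWord-unique [] zs) (cong (_∧ does (unique? zs)) (all-fresh-[] zs)))
  where zs = map ∣_∣ (toList π)

-- A four-state model of the counts modulo 4

-- Which of the letters −m₂ < −m₁ < m₁ < m₂ lie below the previous letter, where m₁ < m₂
-- are the two smallest available values.
data Profile : Set where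
  profile : (b₋₂ b₋₁ b₁ b₂ : Bool) → Profile

belowAll betweenNeg middle betweenPos aboveAll : Profile
belowAll   = profile false false false false
betweenNeg = profile true  false false false
middle     = profile true  true  false false
betweenPos = profile true  true  true  false
aboveAll   = profile true  true  true  true

-- With fewer than two available values the missing letters count as −∞ and +∞.
profileOf : ℤ → List ℕ → Profile
profileOf p []            = middle
profileOf p (m ∷ [])      = profile true ⌊ -[1+ m ] <? p ⌋ ⌊ + suc m <? p ⌋ false
profileOf p (m₁ ∷ m₂ ∷ _) = profile ⌊ -[1+ m₂ ] <? p ⌋ ⌊ -[1+ m₁ ] <? p ⌋ ⌊ + suc m₁ <? p ⌋ ⌊ + suc m₂ <? p ⌋

⌊+<+⌋≡true : ∀ {a b} → a < b → ⌊ + suc a <? + suc b ⌋ ≡ true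
⌊+<+⌋≡true {a} {b} a<b = isYes-true (+ suc a <? + suc b) (+<+ (s≤s a<b))

⌊+<+⌋≡false : ∀ {a b} → b < a → ⌊ + suc a <? + suc b ⌋ ≡ false
⌊+<+⌋≡false {a} {b} b<a = isYes-false (+ suc a <? + suc b) (<-asym (+<+ (s≤s b<a)))

⌊-<-⌋≡true : ∀ {a b} → b < a → ⌊ -[1+ a ] <? -[1+ b ] ⌋ ≡ true
⌊-<-⌋≡true {a} {b} b<a = isYes-true (-[1+ a ] <? -[1+ b ]) (-<- b<a)

⌊-<-⌋≡false : ∀ {a b} → a < b → ⌊ -[1+ a ] <? -[1+ b ] ⌋ ≡ false
⌊-<-⌋≡false {a} {b} a<b = isYes-false (-[1+ a ] <? -[1+ b ]) (<-asym (-<- a<b))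

profileOf-least : ∀ {m₁ m₂} rest → m₁ < m₂ → All (m₂ <_) rest →
  (profileOf (+ suc m₁) (m₂ ∷ rest) ≡ middle) × (profileOf -[1+ m₁ ] (m₂ ∷ rest) ≡ middle)
profileOf-least []        m₁<m₂ [] =
  cong (λ t → profile true true t false) (⌊+<+⌋≡false m₁<m₂) ,
  cong (λ t → profile true t false false) (⌊-<-⌋≡true m₁<m₂)
profileOf-least (m₃ ∷ _)  m₁<m₂ (m₂<m₃ ∷ _) =
  cong₂ (profile true true) (⌊+<+⌋≡false m₁<m₂) (⌊+<+⌋≡false (<-trans m₁<m₂ m₂<m₃)) ,
  cong₂ (λ s t → profile s t false false) (⌊-<-⌋≡true (<-trans m₁<m₂ m₂<m₃)) (⌊-<-⌋≡true m₁<m₂)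

profileOf-second : ∀ {m₁ m₂} rest → m₁ < m₂ → All (m₂ <_) rest →
  (profileOf (+ suc m₂) (m₁ ∷ rest) ≡ betweenPos) × (profileOf -[1+ m₂ ] (m₁ ∷ rest) ≡ betweenNeg)
profileOf-second []       m₁<m₂ [] =
  cong (λ t → profile true true t false) (⌊+<+⌋≡true m₁<m₂) ,
  cong (λ t → profile true t false false) (⌊-<-⌋≡false m₁<m₂)
profileOf-second (m₃ ∷ _) m₁<m₂ (m₂<m₃ ∷ _) =
  cong₂ (profile true true) (⌊+<+⌋≡true m₁<m₂) (⌊+<+⌋≡false m₂<m₃) ,
  cong₂ (λ s t → profile s t false false) (⌊-<-⌋≡true m₂<m₃) (⌊-<-⌋≡false m₁<m₂)

profileOf-beyond : ∀ {m₁ m₂ x} rest → m₁ < x → m₂ < x →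
  (profileOf (+ suc x) (m₁ ∷ m₂ ∷ rest) ≡ aboveAll) × (profileOf -[1+ x ] (m₁ ∷ m₂ ∷ rest) ≡ belowAll)
profileOf-beyond rest m₁<x m₂<x =
  cong₂ (profile true true) (⌊+<+⌋≡true m₁<x) (⌊+<+⌋≡true m₂<x) ,
  cong₂ (λ s t → profile s t false false) (⌊-<-⌋≡false m₂<x) (⌊-<-⌋≡false m₁<x)

-- x, y, z are the values after choosing −m₂, ±m₁, +m₂ respectively; larger letters are
-- left out because they contribute 0 modulo 4.
modelStep : Bool → Profile → ℕ → ℕ → ℕ → ℕ
modelStep b (profile b₋₂ b₋₁ b₁ b₂) x y z =
  ((if does (b₁ Bool.≟ b) then y else 0) + (if does (b₋₁ Bool.≟ b) then y else 0)) +
  ((if does (b₂ Bool.≟ b) then z else 0) + (if does (b₋₂ Bool.≟ b) then x else 0))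

model : ∀ {k} → Vec Bool k → Profile → ℕ
model []          _                     = 1
model (b ∷ [])    (profile _ b₋₁ b₁ _) = (if does (b₁ Bool.≟ b) then 1 else 0) + (if does (b₋₁ Bool.≟ b) then 1 else 0)
model (b ∷ c ∷ S) d                     = modelStep b d (model (c ∷ S) betweenNeg) (model (c ∷ S) middle) (model (c ∷ S) betweenPos)

modelStep-mod-cong : ∀ {m} .{{_ : NonZero m}} b d {x x′ y y′ z z′} →
  x ≈ x′ mod m → y ≈ y′ mod m → z ≈ z′ mod m → modelStep b d x y z ≈ modelStep b d x′ y′ z′ mod m
modelStep-mod-cong b (profile b₋₂ b₋₁ b₁ b₂) x≈ y≈ z≈ =
  +-mod-cong (+-mod-cong (if-mod-cong (does (b₁ Bool.≟ b)) y≈) (if-mod-cong (does (b₋₁ Bool.≟ b)) y≈))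
             (+-mod-cong (if-mod-cong (does (b₂ Bool.≟ b)) z≈) (if-mod-cong (does (b₋₂ Bool.≟ b)) x≈))

-- The possible residues modulo 4 of (model S betweenNeg, model S middle, model S betweenPos),
-- named after the triple.
data State : Set where
  s₂₁₀ s₂₃₀ s₀₁₂ s₀₃₂ : State

atNeg atMiddle atPos : State → ℕ
atNeg s₂₁₀ = 2
atNeg s₂₃₀ = 2
atNeg s₀₁₂ = 0
atNeg s₀₃₂ = 0
atMiddle s₂₁₀ = 1
atMiddle s₂₃₀ = 3
atMiddle s₀₁₂ = 1
atMiddle s₀₃₂ = 3
atPos s₂₁₀ = 0
atPos s₂₃₀ = 0
atPos s₀₁₂ = 2
atPos s₀₃₂ = 2

next : Bool → State → State
next true  s₂₁₀ = s₂₃₀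
next true  s₂₃₀ = s₂₁₀
next true  s    = s
next false s₀₁₂ = s₀₃₂
next false s₀₃₂ = s₀₁₂
next false s    = s

initial : Bool → State
initial true  = s₀₁₂
initial false = s₂₁₀

state : ∀ {k} → Vec Bool (suc k) → State
state (b ∷ [])    = initial b
state (b ∷ c ∷ S) = next b (state (c ∷ S))

state-∷ : ∀ {k} b (S : Vec Bool (suc k)) → state (b ∷ S) ≡ next b (state S)
state-∷ b (c ∷ S) = refl

Residues : ∀ {k} → Vec Bool (suc k) → State → Set
Residues S s = (model S betweenNeg ≈ atNeg s mod 4) × (model S middle ≈ atMiddle s mod 4) × (model S betweenPos ≈ atPos s mod 4)

modelStep-next : ∀ b s →
  (modelStep b betweenNeg (atNeg s) (atMiddle s) (atPos s) ≈ atNeg (next b s) mod 4) ×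
  (modelStep b middle (atNeg s) (atMiddle s) (atPos s) ≈ atMiddle (next b s) mod 4) ×
  (modelStep b betweenPos (atNeg s) (atMiddle s) (atPos s) ≈ atPos (next b s) mod 4)
modelStep-next true  s₂₁₀ = mod-≡ refl , mod-≡ refl , mod-≡ refl
modelStep-next true  s₂₃₀ = mod-≡ refl , mod-≡ refl , mod-≡ refl
modelStep-next true  s₀₁₂ = mod-≡ refl , mod-≡ refl , mod-≡ refl
modelStep-next true  s₀₃₂ = mod-≡ refl , mod-≡ refl , mod-≡ refl
modelStep-next false s₂₁₀ = mod-≡ refl , mod-≡ refl , mod-≡ refl
modelStep-next false s₂₃₀ = mod-≡ refl , mod-≡ refl , mod-≡ refl
modelStep-next false s₀₁₂ = mod-≡ refl , mod-≡ refl , mod-≡ refl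
modelStep-next false s₀₃₂ = mod-≡ refl , mod-≡ refl , mod-≡ refl

model-residues : ∀ {k} (S : Vec Bool (suc k)) → Residues S (state S)
model-residues (true  ∷ [])    = mod-≡ refl , mod-≡ refl , mod-≡ refl
model-residues (false ∷ [])    = mod-≡ refl , mod-≡ refl , mod-≡ refl
model-residues (b ∷ c ∷ S) =
  let x≈ , y≈ , z≈ = model-residues (c ∷ S)
      x′ , y′ , z′ = modelStep-next b (state (c ∷ S))
  in mod-trans (modelStep-mod-cong b betweenNeg x≈ y≈ z≈) x′ ,
     mod-trans (modelStep-mod-cong b middle x≈ y≈ z≈) y′ ,
     mod-trans (modelStep-mod-cong b betweenPos x≈ y≈ z≈) z′

-- Every state has atNeg + 2 · atMiddle + atPos ≡ 0 (mod 4), and this is the whole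
-- contribution of a letter above or below all of −m₂, −m₁, m₁, m₂.
modelStep-outside : ∀ c s →
  (modelStep c aboveAll (atNeg s) (atMiddle s) (atPos s) ≈ 0 mod 4) ×
  (modelStep c belowAll (atNeg s) (atMiddle s) (atPos s) ≈ 0 mod 4)
modelStep-outside true  s₂₁₀ = mod-≡ refl , mod-≡ refl
modelStep-outside true  s₂₃₀ = mod-≡ refl , mod-≡ refl
modelStep-outside true  s₀₁₂ = mod-≡ refl , mod-≡ refl
modelStep-outside true  s₀₃₂ = mod-≡ refl , mod-≡ refl
modelStep-outside false s₂₁₀ = mod-≡ refl , mod-≡ refl
modelStep-outside false s₂₃₀ = mod-≡ refl , mod-≡ refl
modelStep-outside false s₀₁₂ = mod-≡ refl , mod-≡ refl
modelStep-outside false s₀₃₂ = mod-≡ refl , mod-≡ refl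

model-outside : ∀ {k} c (S : Vec Bool (suc k)) →
  (model (c ∷ S) aboveAll ≈ 0 mod 4) × (model (c ∷ S) belowAll ≈ 0 mod 4)
model-outside c (t ∷ S) =
  let x≈ , y≈ , z≈ = model-residues (t ∷ S)
      above , below = modelStep-outside c (state (t ∷ S))
  in mod-trans (modelStep-mod-cong c aboveAll x≈ y≈ z≈) above ,
     mod-trans (modelStep-mod-cong c belowAll x≈ y≈ z≈) below

atMiddle-mod : ∀ s → atMiddle s % 4 ≡ atMiddle s
atMiddle-mod s₂₁₀ = refl
atMiddle-mod s₂₃₀ = refl
atMiddle-mod s₀₁₂ = refl
atMiddle-mod s₀₃₂ = refl

sumStates : (State → ℕ) → ℕ
sumStates f = f s₂₁₀ + f s₂₃₀ + f s₀₁₂ + f s₀₃₂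

sumStates-next : ∀ b f → sumStates (f ∘ next b) ≡ sumStates f
sumStates-next true  f = cong (λ t → t + f s₀₁₂ + f s₀₃₂) (+-comm (f s₂₃₀) (f s₂₁₀))
sumStates-next false f = +.xy∙z≈xz∙y (f s₂₁₀ + f s₂₃₀) (f s₀₃₂) (f s₀₁₂)

sum-state : ∀ k (f : State → ℕ) → sum (map (f ∘ state) (allSubsets (suc (suc k)))) ≡ 2 ^ k * sumStates f
sum-state zero    f = solve 4 (λ a b c d → c :+ (b :+ (d :+ (a :+ con 0))) := con 1 :* (((a :+ b) :+ c) :+ d))
                            refl (f s₂₁₀) (f s₂₃₀) (f s₀₁₂) (f s₀₃₂)
  where open +-*-Solver
sum-state (suc k) f = begin
  sum (map (f ∘ state) (map (true ∷_) W ++ map (false ∷_) W ++ []))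
    ≡⟨ sum-map-++ (f ∘ state) (map (true ∷_) W) _ ⟩
  sum (map (f ∘ state) (map (true ∷_) W)) + sum (map (f ∘ state) (map (false ∷_) W ++ []))
    ≡⟨ cong₂ _+_ (half true) (trans (sum-map-++ (f ∘ state) (map (false ∷_) W) []) (cong (_+ 0) (half false))) ⟩
  2 ^ k * sumStates f + (2 ^ k * sumStates f + 0)
    ≡⟨ solve 2 (λ p s → p :* s :+ (p :* s :+ con 0) := (con 2 :* p) :* s) refl (2 ^ k) (sumStates f) ⟩
  2 ^ suc k * sumStates f ∎
  where
  open ≡-Reasoning
  open +-*-Solver
  W = allSubsets (suc (suc k))
  half : ∀ b → sum (map (f ∘ state) (map (b ∷_) W)) ≡ 2 ^ k * sumStates f
  half b = begin
    sum (map (f ∘ state) (map (b ∷_) W))  ≡⟨ sum-map-∘ (f ∘ state) (b ∷_) W ⟨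
    sum (map (f ∘ state ∘ (b ∷_)) W)      ≡⟨ sum-map-cong (cong f ∘ state-∷ b) W ⟩
    sum (map (f ∘ next b ∘ state) W)      ≡⟨ sum-state k (f ∘ next b) ⟩
    2 ^ k * sumStates (f ∘ next b)        ≡⟨ cong (2 ^ k *_) (sumStates-next b f) ⟩
    2 ^ k * sumStates f                   ∎

-- Counting signed words letter by letter

module SignedWords (n : ℕ) where

  -- An available value k stands for the letters ±(k+1).
  available : List ℕ → List ℕ
  available used = filterᵇ (λ k → fresh (suc k) used) (upTo n)

  available-[] : available [] ≡ upTo n
  available-[] = filter-all (T? ∘ λ _ → true) (All.universal (λ _ → tt) (upTo n))

  available-∷ : ∀ x used → available (suc x ∷ used) ≡ available used ∖ x
  available-∷ x used = filterᵇ-∧ (λ k → not (does (k ≟ x))) (λ k → fresh (suc k) used) (upTo n)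

  available-sorted : ∀ used → AllPairs _<_ (available used)
  available-sorted used = AllPairsₚ.filter⁺ _ (AllPairsₚ.applyUpTo⁺₁ id n (λ i<j _ → i<j))

  -- w completes a prefix ending in the letter p and using the values in used, with descent word S.
  isCompletion : ∀ {k} → ℤ → List ℕ → Vec Bool k → Vec ℤ k → Bool
  isCompletion p used S w = freshWord used (map ∣_∣ (toList w)) ∧ does (≡-dec Bool._≟_ (desAux p w) S)

  completions : (k : ℕ) → ℤ → List ℕ → Vec Bool k → ℕ
  completions k p used S = sum (map (λ w → if isCompletion p used S w then 1 else 0) (words k (letters n)))

  β±≡completions : ∀ S → β± n S ≡ completions n 0ℤ [] S
  β±≡completions S = begin
    β± n S
      ≡⟨ length-filter-as-sum isDes? (signedPerms n) ⟩
    sum (map (λ π → if does (isDes? π) then 1 else 0) (filter isSignedPerm? W))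
      ≡⟨ sum-map-filter isSignedPerm? _ W ⟩
    sum (map (λ π → if does (isSignedPerm? π) then (if does (isDes? π) then 1 else 0) else 0) W)
      ≡⟨ sum-map-cong (λ π → sym (if-∧ (does (isSignedPerm? π)) (does (isDes? π)) 1)) W ⟩
    sum (map (λ π → if does (isSignedPerm? π) ∧ does (isDes? π) then 1 else 0) W)
      ≡⟨ sum-map-cong (λ π → cong (λ b → if b ∧ does (isDes? π) then 1 else 0) (isSignedPerm-freshWord π)) W ⟩
    completions n 0ℤ [] S ∎
    where
    open ≡-Reasoning
    W = words n (letters n)
    isDes? : (π : Vec ℤ n) → Dec (Des π ≡ S)
    isDes? π = ≡-dec Bool._≟_ (Des π) S

  choice : ∀ {k} → ℤ → List ℕ → Bool → Vec Bool k → ℤ → ℕ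
  choice p used b S a = if does (⌊ a <? p ⌋ Bool.≟ b) then completions _ a (∣ a ∣ ∷ used) S else 0

  choices : ∀ {k} → ℤ → List ℕ → Bool → Vec Bool k → ℕ → ℕ
  choices p used b S m = choice p used b S (+ suc m) + choice p used b S -[1+ m ]

  isCompletion-∷ : ∀ {k} p used b (S : Vec Bool k) a w →
    isCompletion p used (b ∷ S) (a ∷ w) ≡ (fresh ∣ a ∣ used ∧ does (⌊ a <? p ⌋ Bool.≟ b)) ∧ isCompletion a (∣ a ∣ ∷ used) S w
  isCompletion-∷ p used b S a w = ∧.interchange (fresh ∣ a ∣ used) (freshWord (∣ a ∣ ∷ used) (map ∣_∣ (toList w)))
                                                 (does (⌊ a <? p ⌋ Bool.≟ b)) (does (≡-dec Bool._≟_ (desAux a w) S))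

  completions-from : ∀ {k} p used b (S : Vec Bool k) a →
    sum (map (λ w → if isCompletion p used (b ∷ S) (a ∷ w) then 1 else 0) (words k (letters n)))
      ≡ (if fresh ∣ a ∣ used then choice p used b S a else 0)
  completions-from {k} p used b S a = begin
    sum (map (λ w → if isCompletion p used (b ∷ S) (a ∷ w) then 1 else 0) W)
      ≡⟨ sum-map-cong (λ w → trans (cong (λ t → if t then 1 else 0) (isCompletion-∷ p used b S a w))
                                   (if-∧ (fa ∧ da) (isCompletion a (∣ a ∣ ∷ used) S w) 1)) W ⟩
    sum (map (λ w → if fa ∧ da then (if isCompletion a (∣ a ∣ ∷ used) S w then 1 else 0) else 0) W)
      ≡⟨ sum-map-if (fa ∧ da) _ W ⟩
    (if fa ∧ da then completions k a (∣ a ∣ ∷ used) S else 0)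
      ≡⟨ if-∧ fa da _ ⟩
    (if fa then choice p used b S a else 0) ∎
    where
    open ≡-Reasoning
    W  = words k (letters n)
    fa = fresh ∣ a ∣ used
    da = does (⌊ a <? p ⌋ Bool.≟ b)

  completions-∷ : ∀ {k} p used b (S : Vec Bool k) →
    completions (suc k) p used (b ∷ S) ≡ sum (map (choices p used b S) (available used))
  completions-∷ {k} p used b S = begin
    completions (suc k) p used (b ∷ S)
      ≡⟨ sum-map-concatMap count (λ a → map (a ∷_) W) (letters n) ⟩
    sum (map (λ a → sum (map count (map (a ∷_) W))) (letters n))
      ≡⟨ sum-map-cong (λ a → trans (sym (sum-map-∘ count (a ∷_) W)) (completions-from p used b S a)) (letters n) ⟩
    sum (map first (letters n))
      ≡⟨ sum-map-concatMap first (λ k → + suc k ∷ - (+ suc k) ∷ []) (upTo n) ⟩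
    sum (map (λ k → first (+ suc k) + (first -[1+ k ] + 0)) (upTo n))
      ≡⟨ sum-map-cong ±-pair (upTo n) ⟩
    sum (map (λ k → if fresh (suc k) used then choices p used b S k else 0) (upTo n))
      ≡⟨ sum-map-filter (T? ∘ λ k → fresh (suc k) used) (choices p used b S) (upTo n) ⟨
    sum (map (choices p used b S) (available used)) ∎
    where
    open ≡-Reasoning
    W = words k (letters n)
    count : Vec ℤ (suc k) → ℕ
    count w = if isCompletion p used (b ∷ S) w then 1 else 0
    first : ℤ → ℕ
    first a = if fresh ∣ a ∣ used then choice p used b S a else 0
    ±-pair : ∀ k → first (+ suc k) + (first -[1+ k ] + 0) ≡ (if fresh (suc k) used then choices p used b S k else 0)
    ±-pair k with fresh (suc k) used
    ... | true  = cong (_+_ (choice p used b S (+ suc k))) (+-identityʳ _)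
    ... | false = refl

  available-least : ∀ used {m₁ m₂ rest} → available used ≡ m₁ ∷ m₂ ∷ rest → All (m₁ <_) (m₂ ∷ rest) →
    available (suc m₁ ∷ used) ≡ m₂ ∷ rest
  available-least used {m₁} {m₂} {rest} av≡ m₁<all = begin
    available (suc m₁ ∷ used)      ≡⟨ available-∷ m₁ used ⟩
    available used ∖ m₁            ≡⟨ cong (_∖ m₁) av≡ ⟩
    (m₁ ∷ m₂ ∷ rest) ∖ m₁          ≡⟨ ∖-∷-self m₁ _ ⟩
    (m₂ ∷ rest) ∖ m₁               ≡⟨ ∖-∉ (All.map (≢-sym ∘ <⇒≢) m₁<all) ⟩
    m₂ ∷ rest                      ∎
    where open ≡-Reasoning

  available-second : ∀ used {m₁ m₂ rest} → available used ≡ m₁ ∷ m₂ ∷ rest → m₁ < m₂ → All (m₂ <_) rest →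
    available (suc m₂ ∷ used) ≡ m₁ ∷ rest
  available-second used {m₁} {m₂} {rest} av≡ m₁<m₂ m₂<rest = begin
    available (suc m₂ ∷ used)      ≡⟨ available-∷ m₂ used ⟩
    available used ∖ m₂            ≡⟨ cong (_∖ m₂) av≡ ⟩
    (m₁ ∷ m₂ ∷ rest) ∖ m₂          ≡⟨ ∖-∷-≢ _ (<⇒≢ m₁<m₂) ⟩
    m₁ ∷ (m₂ ∷ rest) ∖ m₂          ≡⟨ cong (m₁ ∷_) (∖-∷-self m₂ rest) ⟩
    m₁ ∷ rest ∖ m₂                 ≡⟨ cong (m₁ ∷_) (∖-∉ (All.map (≢-sym ∘ <⇒≢) m₂<rest)) ⟩
    m₁ ∷ rest                      ∎
    where open ≡-Reasoning

  available-beyond : ∀ used {m₁ m₂ rest x} → available used ≡ m₁ ∷ m₂ ∷ rest → m₁ < x → m₂ < x →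
    available (suc x ∷ used) ≡ m₁ ∷ m₂ ∷ rest ∖ x
  available-beyond used {m₁} {m₂} {rest} {x} av≡ m₁<x m₂<x = begin
    available (suc x ∷ used)       ≡⟨ available-∷ x used ⟩
    available used ∖ x             ≡⟨ cong (_∖ x) av≡ ⟩
    (m₁ ∷ m₂ ∷ rest) ∖ x           ≡⟨ ∖-∷-≢ _ (<⇒≢ m₁<x) ⟩
    m₁ ∷ (m₂ ∷ rest) ∖ x           ≡⟨ cong (m₁ ∷_) (∖-∷-≢ _ (<⇒≢ m₂<x)) ⟩
    m₁ ∷ m₂ ∷ rest ∖ x             ∎
    where open ≡-Reasoning

  mutual
    completions≈model : ∀ {k} (S : Vec Bool k) p used → length (available used) ≡ k →
      completions k p used S ≈ model S (profileOf p (available used)) mod 4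
    completions≈model []      p used _   = mod-refl
    completions≈model (b ∷ S) p used len =
      mod-trans (≡⇒mod (completions-∷ p used b S))
                (choices≈model b S p used (available used) refl (available-sorted used) len)

    choice≈model : ∀ {k} b (S : Vec Bool k) p used a {av d} →
      available (∣ a ∣ ∷ used) ≡ av → length av ≡ k → profileOf a av ≡ d →
      choice p used b S a ≈ (if does (⌊ a <? p ⌋ Bool.≟ b) then model S d else 0) mod 4
    choice≈model b S p used a refl len refl = if-mod-cong _ (completions≈model S a (∣ a ∣ ∷ used) len)

    choices≈model : ∀ {k} b (S : Vec Bool k) p used av → available used ≡ av → AllPairs _<_ av →
      length av ≡ suc k → sum (map (choices p used b S) av) ≈ model (b ∷ S) (profileOf p av) mod 4
    choices≈model b []      p used []                _ _ ()
    choices≈model b (c ∷ S) p used []                _ _ ()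
    choices≈model b []      p used (m ∷ [])          _ _ _ = ≡⇒mod (+-identityʳ _)
    choices≈model b (c ∷ S) p used (m ∷ [])          _ _ ()
    choices≈model b []      p used (m₁ ∷ m₂ ∷ rest)  _ _ ()
    choices≈model b (c ∷ S) p used (m₁ ∷ m₂ ∷ rest) av≡ (m₁<all@(m₁<m₂ ∷ _) ∷ m₂<rest ∷ rest↑) len =
      +-mod-cong
        (+-mod-cong (choice≈model b (c ∷ S) p used (+ suc m₁) avail₁ len′ (proj₁ least))
                    (choice≈model b (c ∷ S) p used -[1+ m₁ ] avail₁ len′ (proj₂ least)))
        (mod-trans
          (+-mod-cong
            (+-mod-cong (choice≈model b (c ∷ S) p used (+ suc m₂) avail₂ len′ (proj₁ second))
                        (choice≈model b (c ∷ S) p used -[1+ m₂ ] avail₂ len′ (proj₂ second)))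
            (choices-beyond≈0 b (c ∷ S) p used rest av≡ m₁<m₂ m₂<rest rest↑ (suc-injective len′)))
          (≡⇒mod (+-identityʳ _)))
      where
      least  = profileOf-least rest m₁<m₂ m₂<rest
      second = profileOf-second rest m₁<m₂ m₂<rest
      avail₁ = available-least used av≡ m₁<all
      avail₂ = available-second used av≡ m₁<m₂ m₂<rest
      len′   = suc-injective len

    choices-beyond≈0 : ∀ {k} b (S : Vec Bool (suc k)) p used {m₁ m₂} rest → available used ≡ m₁ ∷ m₂ ∷ rest →
      m₁ < m₂ → All (m₂ <_) rest → AllPairs _<_ rest → length rest ≡ k →
      sum (map (choices p used b S) rest) ≈ 0 mod 4
    choices-beyond≈0 b S           p used []       _ _ _ _ _ = mod-refl
    choices-beyond≈0 b (c ∷ [])    p used (_ ∷ _)  _ _ _ _ ()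
    choices-beyond≈0 b (c ∷ t ∷ S) p used rest@(_ ∷ _) av≡ m₁<m₂ m₂<rest rest↑ len =
      sum-mod-zero _ rest λ x∈rest →
        let m₂<x = All.lookup m₂<rest x∈rest
        in  choice-beyond≈0 b (c ∷ t ∷ S) p used (available-beyond used av≡ (<-trans m₁<m₂ m₂<x) m₂<x)
              (<-trans m₁<m₂ m₂<x) m₂<x (suc-injective (trans (length-∖ (AllPairs.map <⇒≢ rest↑) x∈rest) len))

    choice-beyond≈0 : ∀ {k} b (S : Vec Bool (suc (suc k))) p used {m₁ m₂ x rest} →
      available (suc x ∷ used) ≡ m₁ ∷ m₂ ∷ rest → m₁ < x → m₂ < x → length rest ≡ k →
      choices p used b S x ≈ 0 mod 4
    choice-beyond≈0 b (c ∷ S) p used {x = x} {rest} availₓ m₁<x m₂<x len =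
      +-mod-cong
        (mod-trans (choice≈model b (c ∷ S) p used (+ suc x) availₓ len′ (proj₁ outside))
                   (if-mod-zero _ (proj₁ (model-outside c S))))
        (mod-trans (choice≈model b (c ∷ S) p used -[1+ x ] availₓ len′ (proj₂ outside))
                   (if-mod-zero _ (proj₂ (model-outside c S))))
      where
      outside = profileOf-beyond rest m₁<x m₂<x
      len′ = cong (suc ∘ suc) len

β±≡atMiddle : ∀ k (S : Subset (suc (suc k))) → β± (suc (suc k)) S % 4 ≡ atMiddle (state S)
β±≡atMiddle k S = trans (%-≡ β±≈atMiddle) (atMiddle-mod (state S))
  where
  open SignedWords (suc (suc k))
  β±≈atMiddle : β± (suc (suc k)) S ≈ atMiddle (state S) mod 4
  β±≈atMiddle =
    mod-trans (≡⇒mod (β±≡completions S))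
    (mod-trans (completions≈model S 0ℤ [] (trans (cong length available-[]) (length-upTo _)))
    (mod-trans (≡⇒mod (cong (model S ∘ profileOf 0ℤ) available-[]))
               (proj₁ (proj₂ (model-residues S)))))

count-β±-residue : ∀ k v → sumStates (λ s → if does (atMiddle s ≟ v) then 1 else 0) ≡ 2 →
  length (filter (λ S → β± (suc (suc k)) S % 4 ≟ v) (allSubsets (suc (suc k)))) ≡ 2 ^ suc k
count-β±-residue k v two = begin
  length (filter (λ S → β± (suc (suc k)) S % 4 ≟ v) W)
    ≡⟨ length-filter-as-sum (λ S → β± (suc (suc k)) S % 4 ≟ v) W ⟩
  sum (map (λ S → if does (β± (suc (suc k)) S % 4 ≟ v) then 1 else 0) W)
    ≡⟨ sum-map-cong (λ S → cong (λ r → if does (r ≟ v) then 1 else 0) (β±≡atMiddle k S)) W ⟩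
  sum (map (indicator ∘ state) W)  ≡⟨ sum-state k indicator ⟩
  2 ^ k * sumStates indicator      ≡⟨ cong (2 ^ k *_) two ⟩
  2 ^ k * 2                        ≡⟨ *-comm (2 ^ k) 2 ⟩
  2 ^ suc k                        ∎
  where
  open ≡-Reasoning
  W = allSubsets (suc (suc k))
  indicator : State → ℕ
  indicator s = if does (atMiddle s ≟ v) then 1 else 0

theorem4p6 : (n : ℕ) → 2 ≤ n →
    (length (filter (λ S → β± n S % 4 ≟ 1) (allSubsets n)) ≡ 2 ^ (n ∸ 1))
    × (length (filter (λ S → β± n S % 4 ≟ 3) (allSubsets n)) ≡ 2 ^ (n ∸ 1))
theorem4p6 (suc zero)    (s≤s ())
theorem4p6 (suc (suc k)) _ = count-β±-residue k 1 refl , count-β±-residue k 3 refl
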